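{- Let $P:\mathcal{C}^{op}\to\mathbf{InfSL}$ be a primary doctrine with full weak comprehensions. Suppose that, for a given $\alpha\in P(A)$, a weak comprehension $\{\alpha\}:X\to A$ of $\alpha$ is such that $P_{\{\alpha\}}:P(A)\to P(X)$ has a right adjoint $\forall_{\{\alpha\}}:P(X)\to P(A)$. Then the functor $\alpha\wedge-:P(A)\to P(A)$ has a right adjoint $\alpha\Rightarrow-:P(A)\to P(A)$.
   Context: A primary doctrine is a functor $P:\mathcal{C}^{op}\to\mathbf{InfSL}$ where $\mathcal{C}$ has finite products, each $P(A)$ is a poset with finite meets ($\wedge$, top $\top_A$) and each $P_f:P(B)\to P(A)$ is monotone and preserves finite meets. A weak comprehension of $\alpha\in P(A)$ is an arrow $\{\alpha\}:X\to A$ with $\top_X\le P_{\{\alpha\}}(\alpha)$ such that every $g:Y\to A$ with $\top_Y\le P_g(\alpha)$ factors (not necessarily uniquely) as $g=\{\alpha\}\circ h$; it is full if for all $\beta\in P(A)$, $\top_X\le P_{\{\alpha\}}(\beta)$ implies $\alpha\le\beta$. $P$ has full weak comprehensions if every object of every $P(A)$ has a full weak comprehension. -}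

module Defs where

open import Level using (Level; _⊔_; suc)
open import Relation.Binary.PropositionalEquality using (_≡_)
open import Data.Product using (Σ; _×_; Σ-syntax)
open import Function.Bundles using (_⇔_)

-- A (locally small, strict) category; arrows compared with _≡_.
record Category (o h : Level) : Set (suc (o ⊔ h)) where
  infixr 9 _∘_
  field
    Obj  : Set o
    Hom  : Obj → Obj → Set h
    id   : ∀ {A} → Hom A A
    _∘_  : ∀ {A B C} → Hom B C → Hom A B → Hom A C
    identityˡ : ∀ {A B} (f : Hom A B) → id ∘ f ≡ f
    identityʳ : ∀ {A B} (f : Hom A B) → f ∘ id ≡ f
    assoc : ∀ {A B C D} (f : Hom C D) (g : Hom B C) (k : Hom A B) →
            (f ∘ g) ∘ k ≡ f ∘ (g ∘ k)

record HasFiniteProducts {o h : Level} (𝒞 : Category o h) : Set (o ⊔ h) where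
  open Category 𝒞
  field
    𝟙   : Obj
    !   : ∀ {A} → Hom A 𝟙
    !-unique : ∀ {A} (f : Hom A 𝟙) → f ≡ !
    _×ₒ_ : Obj → Obj → Obj
    π₁  : ∀ {A B} → Hom (A ×ₒ B) A
    π₂  : ∀ {A B} → Hom (A ×ₒ B) B
    ⟨_,_⟩ : ∀ {C A B} → Hom C A → Hom C B → Hom C (A ×ₒ B)
    π₁-β : ∀ {C A B} (f : Hom C A) (g : Hom C B) → π₁ ∘ ⟨ f , g ⟩ ≡ f
    π₂-β : ∀ {C A B} (f : Hom C A) (g : Hom C B) → π₂ ∘ ⟨ f , g ⟩ ≡ g
    ⟨⟩-unique : ∀ {C A B} (f : Hom C A) (g : Hom C B) (u : Hom C (A ×ₒ B)) →
                π₁ ∘ u ≡ f → π₂ ∘ u ≡ g → u ≡ ⟨ f , g ⟩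

record PrimaryDoctrine (o h p r : Level) : Set (suc (o ⊔ h ⊔ p ⊔ r)) where
  field
    𝒞        : Category o h
    products : HasFiniteProducts 𝒞
  open Category 𝒞
  field
    P    : Obj → Set p
    _≤_  : ∀ {A} → P A → P A → Set r
    ≤-refl    : ∀ {A} {x : P A} → x ≤ x
    ≤-trans   : ∀ {A} {x y z : P A} → x ≤ y → y ≤ z → x ≤ z
    ≤-antisym : ∀ {A} {x y : P A} → x ≤ y → y ≤ x → x ≡ y
    ⊤    : ∀ A → P A
    ⊤-max : ∀ {A} (x : P A) → x ≤ ⊤ A
    _∧_  : ∀ {A} → P A → P A → P A
    ∧-lb₁ : ∀ {A} (x y : P A) → (x ∧ y) ≤ x
    ∧-lb₂ : ∀ {A} (x y : P A) → (x ∧ y) ≤ y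
    ∧-glb : ∀ {A} {x y z : P A} → z ≤ x → z ≤ y → z ≤ (x ∧ y)
    P₁   : ∀ {A B} → Hom A B → P B → P A
    P₁-mono : ∀ {A B} (f : Hom A B) {x y : P B} → x ≤ y → P₁ f x ≤ P₁ f y
    P₁-⊤ : ∀ {A B} (f : Hom A B) → P₁ f (⊤ B) ≡ ⊤ A
    P₁-∧ : ∀ {A B} (f : Hom A B) (x y : P B) → P₁ f (x ∧ y) ≡ (P₁ f x ∧ P₁ f y)
    P₁-id : ∀ {A} (x : P A) → P₁ (id {A}) x ≡ x
    P₁-∘  : ∀ {A B C} (g : Hom B C) (f : Hom A B) (x : P C) →
            P₁ (g ∘ f) x ≡ P₁ f (P₁ g x)

module _ {o h p r : Level} (D : PrimaryDoctrine o h p r) where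
  open PrimaryDoctrine D
  open Category 𝒞

  record IsWeakComprehension {A X : Obj} (α : P A) (c : Hom X A) : Set (o ⊔ h ⊔ r) where
    field
      holds  : ⊤ X ≤ P₁ c α
      weakUP : ∀ {Y} (g : Hom Y A) → ⊤ Y ≤ P₁ g α → Σ[ k ∈ Hom Y X ] (c ∘ k ≡ g)

  IsFull : ∀ {A X : Obj} (α : P A) (c : Hom X A) → Set (p ⊔ r)
  IsFull {A} {X} α c = ∀ (β : P A) → ⊤ X ≤ P₁ c β → α ≤ β

  HasFullWeakComprehensions : Set (o ⊔ h ⊔ p ⊔ r)
  HasFullWeakComprehensions =
    ∀ (A : Obj) (α : P A) →
      Σ[ X ∈ Obj ] Σ[ c ∈ Hom X A ] (IsWeakComprehension α c × IsFull α c)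

  IsRightAdjoint : ∀ {X Y : Obj} (L : P X → P Y) (R : P Y → P X) → Set (p ⊔ r)
  IsRightAdjoint {X} {Y} L R = ∀ (x : P X) (y : P Y) → (L x ≤ y) ⇔ (x ≤ R y)

  HasRightAdjoint : ∀ {X Y : Obj} (L : P X → P Y) → Set (p ⊔ r)
  HasRightAdjoint {X} {Y} L = Σ[ R ∈ (P Y → P X) ] IsRightAdjoint L R

-- Write c for {α} and take α ⇒ β := ∀_c (P_c β). By P_c ⊣ ∀_c it suffices that
-- α ∧ γ ≤ β iff P_c γ ≤ P_c β. Forwards, P_c α is top. Backwards, a full weak
-- comprehension d of α ∧ γ satisfies α along d, so it factors through c; hence γ, and
-- then β, is true along d, and fullness of d gives α ∧ γ ≤ β.
module Submission where

open import Defs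
open import Level using (Level)
open import Data.Product using (_,_)
open import Function.Bundles using (_⇔_; mk⇔)
open import Function.Construct.Composition using (_⇔-∘_)
open import Relation.Binary.PropositionalEquality using (_≡_; refl; subst; subst₂; sym)

module _ {o h p r : Level} (D : PrimaryDoctrine o h p r) where
  open PrimaryDoctrine D
  open Category 𝒞

  ≤-respˡ-≡ : ∀ {B} {x y z : P B} → x ≡ y → x ≤ z → y ≤ z
  ≤-respˡ-≡ x≡y = subst (_≤ _) x≡y

  P₁-mono-factor : ∀ {Y X B} {c : Hom X B} {k : Hom Y X} {g : Hom Y B} {x y : P B} →
                   c ∘ k ≡ g → P₁ c x ≤ P₁ c y → P₁ g x ≤ P₁ g y
  P₁-mono-factor {c = c} {k} {x = x} {y} refl cx≤cy =
    subst₂ _≤_ (sym (P₁-∘ c k x)) (sym (P₁-∘ c k y)) (P₁-mono k cx≤cy)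

  ⊤≤P₁-mono : ∀ {Y B} (g : Hom Y B) {x y : P B} → ⊤ Y ≤ P₁ g x → x ≤ y → ⊤ Y ≤ P₁ g y
  ⊤≤P₁-mono g ⊤≤gx x≤y = ≤-trans ⊤≤gx (P₁-mono g x≤y)

  module _ {A X : Obj} {α : P A} {c : Hom X A} (wc : IsWeakComprehension D α c) where
    open IsWeakComprehension wc

    ∧-≤⇒P₁-≤ : ∀ {γ β : P A} → (α ∧ γ) ≤ β → P₁ c γ ≤ P₁ c β
    ∧-≤⇒P₁-≤ {γ} α∧γ≤β =
      ≤-trans (∧-glb (≤-trans (⊤-max _) holds) ≤-refl)
        (≤-respˡ-≡ (P₁-∧ c α γ) (P₁-mono c α∧γ≤β))

    P₁-≤⇒∧-≤ : HasFullWeakComprehensions D →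
               ∀ {γ β : P A} → P₁ c γ ≤ P₁ c β → (α ∧ γ) ≤ β
    P₁-≤⇒∧-≤ fwc {γ} {β} cγ≤cβ with fwc A (α ∧ γ)
    ... | _ , d , wd , full with IsWeakComprehension.holds wd
    ...   | ⊤≤dα∧γ with weakUP d (⊤≤P₁-mono d ⊤≤dα∧γ (∧-lb₁ α γ))
    ...     | _ , c∘k≡d =
      full β (≤-trans (⊤≤P₁-mono d ⊤≤dα∧γ (∧-lb₂ α γ)) (P₁-mono-factor c∘k≡d cγ≤cβ))

    ∧-≤⇔P₁-≤ : HasFullWeakComprehensions D →
               ∀ {γ β : P A} → ((α ∧ γ) ≤ β) ⇔ (P₁ c γ ≤ P₁ c β)
    ∧-≤⇔P₁-≤ fwc = mk⇔ ∧-≤⇒P₁-≤ (P₁-≤⇒∧-≤ fwc)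

lemma4p9 : ∀ {o h p r : Level} (D : PrimaryDoctrine o h p r) →
           HasFullWeakComprehensions D →
           ∀ {A X : Category.Obj (PrimaryDoctrine.𝒞 D)} (α : PrimaryDoctrine.P D A)
             (c : Category.Hom (PrimaryDoctrine.𝒞 D) X A) →
           IsWeakComprehension D α c →
           HasRightAdjoint D (PrimaryDoctrine.P₁ D c) →
           HasRightAdjoint D (λ β → PrimaryDoctrine._∧_ D α β)
lemma4p9 D fwc α c wc (∀c , P₁c⊣∀c) =
  (λ β → ∀c (P₁ c β)) , λ γ β → P₁c⊣∀c γ (P₁ c β) ⇔-∘ ∧-≤⇔P₁-≤ D wc fwc
  where open PrimaryDoctrine D using (P₁)
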